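{- The logic $\mathbf{WW}$ is strongly complete with respect to the class of all $\mathsf{WW}$-PN-frames, and also with respect to the class of those $\mathsf{WW}$-PN-frames satisfying: for all $w,v\in W$, $X\subseteq W$, if $w\leq v$ and $X\in\mathcal{N}_w$ then $X\in\mathcal{N}_v$. That is, for each of these classes, for every set $\Gamma$ of formulas and formula $\varphi$ with $\Gamma\nvdash_{\mathbf{WW}}\varphi$, there is a model based on a frame of the class and a world forcing all members of $\Gamma$ but not $\varphi$.
   Context: Formulas are built from a countable set $PV$ of propositional variables and $\bot$ by $\land,\lor,\rightarrow$ and a unary modal operator $\mathsf{W}$; $\lnot\varphi$ abbreviates $\varphi\to\bot$, $\varphi\leftrightarrow\psi$ abbreviates $(\varphi\to\psi)\land(\psi\to\varphi)$. The logic $\mathbf{WW}$ is the smallest set of formulas containing all instances of the axiom schemes of intuitionistic propositional logic, all instances of $\mathsf{W}\varphi\to\lnot\varphi$ and of $(\mathsf{W}\varphi\land\mathsf{W}\psi)\to\mathsf{W}(\varphi\land\psi)$, closed under modus ponens and the rule: from $\varphi\leftrightarrow\psi$ infer $\mathsf{W}\varphi\leftrightarrow\mathsf{W}\psi$. $\Gamma\vdash_{\mathbf{WW}}\varphi$ means there are $\gamma_1,\dots,\gamma_n\in\Gamma$ ($n\ge0$) with $(\gamma_1\land\dots\land\gamma_n)\to\varphi\in\mathbf{WW}$. A $\mathsf{WW}$-PN-frame is a triple $\langle W,\mathcal{N},\leq\rangle$ with $\leq$ a partial order on $W$ and $\mathcal{N}:W\to P(P(W))$ such that (i) if $w\leq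 v$, $X\in\mathcal{N}_w$ and $v\notin X$ then $X\in\mathcal{N}_v$, and (ii) $X,Y\in\mathcal{N}_w$ implies $X\cap Y\in\mathcal{N}_w$. A model on a frame adds $V:PV\to P(W)$ with each $V(q)$ upward closed. Forcing: $w\nVdash\bot$; $w\Vdash q$ iff $w\in V(q)$; $\land,\lor$ pointwise; $w\Vdash\varphi\to\psi$ iff for all $v\geq w$, $v\nVdash\varphi$ or $v\Vdash\psi$; $w\Vdash\mathsf{W}\varphi$ iff $w\Vdash\lnot\varphi$ and $V(\varphi)\in\mathcal{N}_w$, where $V(\varphi)=\{z:z\Vdash\varphi\}$. -}

module Defs where

open import Level using (Level; 0ℓ) renaming (suc to lsuc)
open import Data.Nat using (ℕ)
open import Data.List using (List; []; _∷_)
open import Data.List.Relation.Unary.All using (All)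
open import Data.Product using (Σ; _×_; _,_)
open import Data.Sum using (_⊎_)
open import Relation.Nullary using (¬_)
open import Relation.Binary.PropositionalEquality using (_≡_)
open import Relation.Binary.Structures using (IsPartialOrder)
open import Function.Bundles using (_⇔_)
import Data.Empty
import Data.Unit

infixr 6 _∧'_
infixr 5 _∨'_
infixr 4 _⇒_

data Formula : Set where
  var  : ℕ → Formula
  ⊥'   : Formula
  _∧'_ : Formula → Formula → Formula
  _∨'_ : Formula → Formula → Formula
  _⇒_  : Formula → Formula → Formula
  𝖶    : Formula → Formula

¬' : Formula → Formula
¬' φ = φ ⇒ ⊥'

_⇔'_ : Formula → Formula → Formula
φ ⇔' ψ = (φ ⇒ ψ) ∧' (ψ ⇒ φ)

⊤' : Formula
⊤' = ⊥' ⇒ ⊥'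

data WW : Formula → Set where
  ax-K     : ∀ φ ψ → WW (φ ⇒ ψ ⇒ φ)
  ax-S     : ∀ φ ψ χ → WW ((φ ⇒ ψ ⇒ χ) ⇒ (φ ⇒ ψ) ⇒ φ ⇒ χ)
  ax-∧E₁   : ∀ φ ψ → WW (φ ∧' ψ ⇒ φ)
  ax-∧E₂   : ∀ φ ψ → WW (φ ∧' ψ ⇒ ψ)
  ax-∧I    : ∀ φ ψ → WW (φ ⇒ ψ ⇒ φ ∧' ψ)
  ax-∨I₁   : ∀ φ ψ → WW (φ ⇒ φ ∨' ψ)
  ax-∨I₂   : ∀ φ ψ → WW (ψ ⇒ φ ∨' ψ)
  ax-∨E    : ∀ φ ψ χ → WW ((φ ⇒ χ) ⇒ (ψ ⇒ χ) ⇒ φ ∨' ψ ⇒ χ)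
  ax-⊥E    : ∀ φ → WW (⊥' ⇒ φ)
  ax-W¬    : ∀ φ → WW (𝖶 φ ⇒ ¬' φ)
  ax-W∧    : ∀ φ ψ → WW (𝖶 φ ∧' 𝖶 ψ ⇒ 𝖶 (φ ∧' ψ))
  mp       : ∀ {φ ψ} → WW (φ ⇒ ψ) → WW φ → WW ψ
  re       : ∀ {φ ψ} → WW (φ ⇔' ψ) → WW (𝖶 φ ⇔' 𝖶 ψ)

⋀ : List Formula → Formula
⋀ []           = ⊤'
⋀ (γ ∷ [])     = γ
⋀ (γ ∷ γ' ∷ γs) = γ ∧' ⋀ (γ' ∷ γs)

FSet : Set₁
FSet = Formula → Set

_⊢_ : FSet → Formula → Set
Γ ⊢ φ = Σ (List Formula) λ γs → All Γ γs × WW (⋀ γs ⇒ φ)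

record Frame (ℓ : Level) : Set (lsuc ℓ) where
  field
    W      : Set ℓ
    _≤_    : W → W → Set ℓ
    isPO   : IsPartialOrder _≡_ _≤_
    𝒩      : W → (W → Set ℓ) → Set ℓ
    -- 𝒩_w is a set of *sets*: it respects extensional equality of subsets
    𝒩-ext  : ∀ {w} (X Y : W → Set ℓ) → (∀ z → X z ⇔ Y z) → 𝒩 w X → 𝒩 w Y
    cond-i  : ∀ {w v} (X : W → Set ℓ) → w ≤ v → 𝒩 w X → ¬ X v → 𝒩 v X
    cond-ii : ∀ {w} (X Y : W → Set ℓ) → 𝒩 w X → 𝒩 w Y → 𝒩 w (λ z → X z × Y z)

Monotone : ∀ {ℓ} → Frame ℓ → Set (lsuc ℓ)
Monotone F = ∀ {w v} (X : W → Set _) → w ≤ v → 𝒩 w X → 𝒩 v X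
  where open Frame F

record Model (ℓ : Level) : Set (lsuc ℓ) where
  field
    frame : Frame ℓ
  open Frame frame public
  field
    V      : ℕ → W → Set ℓ
    V-up   : ∀ q {w v} → w ≤ v → V q w → V q v

module _ {ℓ} (M : Model ℓ) where
  open Model M

  infix 3 _⊩_
  _⊩_ : W → Formula → Set ℓ
  w ⊩ var q    = V q w
  w ⊩ ⊥'       = Level.Lift ℓ Data.Empty.⊥
  w ⊩ φ ∧' ψ   = (w ⊩ φ) × (w ⊩ ψ)
  w ⊩ φ ∨' ψ   = (w ⊩ φ) ⊎ (w ⊩ ψ)
  w ⊩ φ ⇒ ψ    = ∀ v → w ≤ v → v ⊩ φ → v ⊩ ψ
  -- w ⊩ ¬φ unfolded (¬φ = φ → ⊥)
  w ⊩ 𝖶 φ      = (∀ v → w ≤ v → v ⊩ φ → Level.Lift ℓ Data.Empty.⊥) × 𝒩 w (λ z → z ⊩ φ)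

Countermodel : ∀ {ℓ} → (Frame ℓ → Set (lsuc ℓ)) → FSet → Formula → Set (lsuc ℓ)
Countermodel {ℓ} Cls Γ φ =
  Σ (Model ℓ) λ M → Cls (Model.frame M) ×
    Σ (Model.W M) λ w → (∀ γ → Γ γ → _⊩_ M w γ) × ¬ (_⊩_ M w φ)

AllFrames : ∀ {ℓ} → Frame ℓ → Set (lsuc ℓ)
AllFrames {ℓ} _ = Level.Lift (lsuc ℓ) Data.Unit.⊤

StronglyComplete : ∀ ℓ → (Frame ℓ → Set (lsuc ℓ)) → Set (lsuc ℓ)
StronglyComplete ℓ Cls = ∀ (Γ : FSet) (φ : Formula) → ¬ (Γ ⊢ φ) → Countermodel Cls Γ φ

-- Canonical model argument. Worlds are the prime theories, ordered by inclusion, and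
-- the neighbourhoods of T are the truth sets of the formulas ψ with 𝖶 ψ ∈ T. Axiom W∧
-- gives closure under intersection, and neighbourhoods only grow along the order, so
-- the frame is monotone and one model serves both classes. In the truth lemma for 𝖶,
-- two formulas with the same truth set are provably equivalent (by Lindenbaum's lemma,
-- proved with excluded middle over an enumeration of the formulas), so rule RE
-- transfers 𝖶 from one to the other.
module Submission where

open import Defs
open import Level using (0ℓ; Lift; lift; lower) renaming (suc to lsuc)
open import Axiom.ExcludedMiddle using (ExcludedMiddle)
open import Data.Empty using (⊥-elim) renaming (⊥ to ⊥₀)
open import Data.List using (List; []; _∷_; _++_)
open import Data.List.Membership.Propositional using (_∈_)
open import Data.List.Membership.Propositional.Properties using (∈-++⁺ˡ; ∈-++⁺ʳ)
open import Data.List.Relation.Unary.All using (All; []; _∷_)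
open import Data.List.Relation.Unary.All.Properties using (++⁺)
open import Data.List.Relation.Unary.Any using (here; there)
open import Data.Nat using (ℕ; zero; suc; _+_; _⊔_; _≤_; _≤′_; ≤′-refl; ≤′-step; s≤s)
open import Data.Nat.Properties using (+-suc; +-identityʳ; suc-injective; ≤-refl; ≤-trans; ≤⇒≤′; m≤m⊔n; m≤n⊔m)
open import Data.Product using (Σ; ∃; _×_; _,_; proj₁; proj₂; uncurry; map)
open import Data.Product.Function.NonDependent.Propositional using (_×-⇔_)
open import Data.Sum using (_⊎_; inj₁; inj₂; [_,_]; map₁; map₂)
open import Data.Sum.Function.Propositional using (_⊎-⇔_)
open import Data.Unit using (tt)
open import Function using (_∘_)
open import Function.Bundles using (_⇔_; mk⇔; Equivalence)
open import Function.Properties.Equivalence using () renaming (sym to ⇔-sym; trans to ⇔-trans)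
open import Relation.Nullary using (¬_; Dec; yes; no)
open import Relation.Nullary.Decidable using (map′; decidable-stable)
open import Relation.Binary.PropositionalEquality using (_≡_; refl; sym; trans; cong; cong₂; module ≡-Reasoning)
open import Relation.Binary.PropositionalEquality.Properties using () renaming (isEquivalence to ≡-isEquivalence)
open import Relation.Binary.Structures using (IsPartialOrder)

open Equivalence using (to; from)

infix 3.5 _⊢ₕ_
infixl 5 _,,_

data _⊢ₕ_ (Γ : FSet) : Formula → Set where
  hyp : ∀ {φ} → Γ φ → Γ ⊢ₕ φ
  thm : ∀ {φ} → WW φ → Γ ⊢ₕ φ
  app : ∀ {φ ψ} → Γ ⊢ₕ φ ⇒ ψ → Γ ⊢ₕ φ → Γ ⊢ₕ ψ

∅ : FSet
∅ _ = ⊥₀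

_,,_ : FSet → Formula → FSet
(Γ ,, ψ) χ = Γ χ ⊎ χ ≡ ψ

_⊆_ : FSet → FSet → Set
Γ ⊆ Δ = ∀ {χ} → Γ χ → Δ χ

⇒-refl : ∀ φ → WW (φ ⇒ φ)
⇒-refl φ = mp (mp (ax-S φ (φ ⇒ φ) φ) (ax-K φ (φ ⇒ φ))) (ax-K φ φ)

deduction : ∀ {Γ ψ χ} → Γ ,, ψ ⊢ₕ χ → Γ ⊢ₕ ψ ⇒ χ
deduction {ψ = ψ} {χ} (hyp (inj₁ χ∈Γ)) = app (thm (ax-K χ ψ)) (hyp χ∈Γ)
deduction (hyp (inj₂ refl))            = thm (⇒-refl _)
deduction {ψ = ψ} {χ} (thm p)          = app (thm (ax-K χ ψ)) (thm p)
deduction {ψ = ψ} {χ} (app {φ} p q)    = app (app (thm (ax-S ψ φ χ)) (deduction p)) (deduction q)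

⊢ₕ-cut : ∀ {Γ Δ φ} → (∀ {χ} → Γ χ → Δ ⊢ₕ χ) → Γ ⊢ₕ φ → Δ ⊢ₕ φ
⊢ₕ-cut Γ⊢Δ (hyp χ∈Γ) = Γ⊢Δ χ∈Γ
⊢ₕ-cut Γ⊢Δ (thm p)   = thm p
⊢ₕ-cut Γ⊢Δ (app p q) = app (⊢ₕ-cut Γ⊢Δ p) (⊢ₕ-cut Γ⊢Δ q)

⊢ₕ-mono : ∀ {Γ Δ φ} → Γ ⊆ Δ → Γ ⊢ₕ φ → Δ ⊢ₕ φ
⊢ₕ-mono Γ⊆Δ = ⊢ₕ-cut (hyp ∘ Γ⊆Δ)

∅⊢ₕ⇒WW : ∀ {φ} → ∅ ⊢ₕ φ → WW φ
∅⊢ₕ⇒WW (thm p)   = p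
∅⊢ₕ⇒WW (app p q) = mp (∅⊢ₕ⇒WW p) (∅⊢ₕ⇒WW q)

listSet : List Formula → FSet
listSet γs χ = χ ∈ γs

⊢ₕ-compact : ∀ {Γ φ} → Γ ⊢ₕ φ → Σ (List Formula) λ γs → All Γ γs × listSet γs ⊢ₕ φ
⊢ₕ-compact {φ = φ} (hyp φ∈Γ) = φ ∷ [] , φ∈Γ ∷ [] , hyp (here refl)
⊢ₕ-compact (thm p)           = [] , [] , thm p
⊢ₕ-compact (app p q) with ⊢ₕ-compact p | ⊢ₕ-compact q
... | γs , γs⊆Γ , dp | δs , δs⊆Γ , dq =
  γs ++ δs , ++⁺ γs⊆Γ δs⊆Γ , app (⊢ₕ-mono ∈-++⁺ˡ dp) (⊢ₕ-mono (∈-++⁺ʳ γs) dq)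

⋀-elim : ∀ {Γ γ} γs → γ ∈ γs → Γ ⊢ₕ ⋀ γs → Γ ⊢ₕ γ
⋀-elim (_ ∷ [])     (here refl) d = d
⋀-elim (_ ∷ _ ∷ _)  (here refl) d = app (thm (ax-∧E₁ _ _)) d
⋀-elim (_ ∷ γ ∷ γs) (there γ∈)  d = ⋀-elim (γ ∷ γs) γ∈ (app (thm (ax-∧E₂ _ _)) d)

⊢ₕ⇒⊢ : ∀ {Γ φ} → Γ ⊢ₕ φ → Γ ⊢ φ
⊢ₕ⇒⊢ d with ⊢ₕ-compact d
... | γs , γs⊆Γ , dγs =
  γs , γs⊆Γ , ∅⊢ₕ⇒WW (deduction (⊢ₕ-cut (λ γ∈ → ⋀-elim γs γ∈ (hyp (inj₂ refl))) dγs))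

⋃ : (ℕ → FSet) → FSet
⋃ S ψ = ∃ λ n → S n ψ

module _ (S : ℕ → FSet) (S-step : ∀ n → S n ⊆ S (suc n)) where

  chain-⊆ : ∀ {m n} → m ≤′ n → S m ⊆ S n
  chain-⊆ ≤′-refl      ψ∈S = ψ∈S
  chain-⊆ (≤′-step m≤n) ψ∈S = S-step _ (chain-⊆ m≤n ψ∈S)

  ⋃-compact : ∀ {ψ} → ⋃ S ⊢ₕ ψ → ∃ λ n → S n ⊢ₕ ψ
  ⋃-compact (hyp (n , ψ∈S)) = n , hyp ψ∈S
  ⋃-compact (thm p)         = 0 , thm p
  ⋃-compact (app p q) with ⋃-compact p | ⋃-compact q
  ... | m , dp | n , dq =
    m ⊔ n , app (⊢ₕ-mono (chain-⊆ (≤⇒≤′ (m≤m⊔n m n))) dp) (⊢ₕ-mono (chain-⊆ (≤⇒≤′ (m≤n⊔m m n))) dq)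

-- Cantor's enumeration: each diagonal a + b = s is walked from (s , 0) to (0 , s).
next : ℕ × ℕ → ℕ × ℕ
next (zero  , b) = suc b , zero
next (suc a , b) = a , suc b

unpair : ℕ → ℕ × ℕ
unpair zero    = 0 , 0
unpair (suc n) = next (unpair n)

unpair-surjective : ∀ a b → ∃ λ n → unpair n ≡ (a , b)
unpair-surjective a b = onDiagonal (a + b) a b refl
  where
  onDiagonal : ∀ s a b → a + b ≡ s → ∃ λ n → unpair n ≡ (a , b)
  onDiagonal s       zero    zero    _ = 0 , refl
  onDiagonal s       a       (suc b) a+b≡s with onDiagonal s (suc a) b (trans (sym (+-suc a b)) a+b≡s)
  ... | n , n↦ = suc n , cong next n↦
  onDiagonal (suc s) (suc a) zero    a+b≡s with onDiagonal s zero a (trans (sym (+-identityʳ a)) (suc-injective a+b≡s))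
  ... | n , n↦ = suc n , cong next n↦

-- decode f c reads the formula coded by c, with fuel f bounding its depth;
-- running out of fuel and unused tags both yield ⊥'.
decode       : ℕ → ℕ → Formula
decodeTagged : ℕ → ℕ × ℕ → Formula
decodeBinary : (Formula → Formula → Formula) → ℕ → ℕ → Formula

decode zero    _ = ⊥'
decode (suc f) c = decodeTagged f (unpair c)

decodeTagged f (0 , m) = var m
decodeTagged f (1 , m) = 𝖶 (decode f m)
decodeTagged f (2 , m) = decodeBinary _∧'_ f m
decodeTagged f (3 , m) = decodeBinary _∨'_ f m
decodeTagged f (4 , m) = decodeBinary _⇒_ f m
decodeTagged f _       = ⊥'

decodeBinary op f m = op (decode f (proj₁ (unpair m))) (decode f (proj₂ (unpair m)))

Decodable : Formula → Set
Decodable φ = Σ ℕ λ c → Σ ℕ λ d → ∀ f → d ≤ f → decode f c ≡ φ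

decodable-binary : ∀ t (op : Formula → Formula → Formula) →
  (∀ f m → decodeTagged f (t , m) ≡ decodeBinary op f m) →
  ∀ {a b} → Decodable a → Decodable b → Decodable (op a b)
decodable-binary t op tag {a} {b} (ca , da , ha) (cb , db , hb)
  with unpair-surjective ca cb
... | m , m↦ with unpair-surjective t m
... | c , c↦ = c , suc (da ⊔ db) , decodesAt
  where
  open ≡-Reasoning
  decodesAt : ∀ f → suc (da ⊔ db) ≤ f → decode f c ≡ op a b
  decodesAt (suc f) (s≤s d≤f) = begin
    decodeTagged f (unpair c)                      ≡⟨ cong (decodeTagged f) c↦ ⟩
    decodeTagged f (t , m)                         ≡⟨ tag f m ⟩
    decodeBinary op f m                            ≡⟨ cong (λ p → op (decode f (proj₁ p)) (decode f (proj₂ p))) m↦ ⟩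
    op (decode f ca) (decode f cb)                 ≡⟨ cong₂ op (ha f (≤-trans (m≤m⊔n da db) d≤f))
                                                               (hb f (≤-trans (m≤n⊔m da db) d≤f)) ⟩
    op a b                                         ∎

decodable : ∀ φ → Decodable φ
decodable (var q) with unpair-surjective 0 q
... | c , c↦ = c , 1 , λ { (suc f) _ → cong (decodeTagged f) c↦ }
decodable ⊥' with unpair-surjective 5 0
... | c , c↦ = c , 0 , λ { zero _ → refl ; (suc f) _ → cong (decodeTagged f) c↦ }
decodable (a ∧' b) = decodable-binary 2 _∧'_ (λ _ _ → refl) (decodable a) (decodable b)
decodable (a ∨' b) = decodable-binary 3 _∨'_ (λ _ _ → refl) (decodable a) (decodable b)
decodable (a ⇒ b)  = decodable-binary 4 _⇒_  (λ _ _ → refl) (decodable a) (decodable b)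
decodable (𝖶 a) with decodable a
... | ca , da , ha with unpair-surjective 1 ca
... | c , c↦ = c , suc da , λ { (suc f) (s≤s d≤f) → trans (cong (decodeTagged f) c↦) (cong 𝖶 (ha f d≤f)) }

enumerate : ℕ → Formula
enumerate = uncurry decode ∘ unpair

enumerate-surjective : ∀ φ → ∃ λ n → enumerate n ≡ φ
enumerate-surjective φ with decodable φ
... | c , d , decodes with unpair-surjective d c
... | n , n↦ = n , trans (cong (uncurry decode) n↦) (decodes d ≤-refl)

record PrimeTheory : Set₁ where
  field
    formulas   : FSet
    closed     : ∀ {ψ} → formulas ⊢ₕ ψ → formulas ψ
    prime      : ∀ {ψ χ} → formulas (ψ ∨' χ) → formulas ψ ⊎ formulas χ
    consistent : ¬ formulas ⊥'
open PrimeTheory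

infix 3.5 _∋_
_∋_ : PrimeTheory → Formula → Set
T ∋ φ = formulas T φ

module _ (T : PrimeTheory) where

  ∋-WW : ∀ {φ} → WW φ → T ∋ φ
  ∋-WW = closed T ∘ thm

  ∋-mp : ∀ {φ ψ} → T ∋ φ ⇒ ψ → T ∋ φ → T ∋ ψ
  ∋-mp φ⇒ψ φ = closed T (app (hyp φ⇒ψ) (hyp φ))

  ∋-∧⇔ : ∀ {φ ψ} → (T ∋ φ ∧' ψ) ⇔ (T ∋ φ × T ∋ ψ)
  ∋-∧⇔ = mk⇔ (λ φ∧ψ → ∋-mp (∋-WW (ax-∧E₁ _ _)) φ∧ψ , ∋-mp (∋-WW (ax-∧E₂ _ _)) φ∧ψ)
             (λ (φ , ψ) → ∋-mp (∋-mp (∋-WW (ax-∧I _ _)) φ) ψ)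

  ∋-∨⇔ : ∀ {φ ψ} → (T ∋ φ ∨' ψ) ⇔ (T ∋ φ ⊎ T ∋ ψ)
  ∋-∨⇔ = mk⇔ (prime T) [ ∋-mp (∋-WW (ax-∨I₁ _ _)) , ∋-mp (∋-WW (ax-∨I₂ _ _)) ]

module Canonical (em : ExcludedMiddle (lsuc 0ℓ)) where

  decide : (P : Set) → Dec P
  decide P = map′ lower lift em

  by-contradiction : {P : Set} → ¬ ¬ P → P
  by-contradiction = decidable-stable (decide _)

  module Lindenbaum (Γ : FSet) (φ : Formula) (Γ⊬φ : ¬ Γ ⊢ₕ φ) where

    stage : ℕ → FSet
    stage zero      = Γ
    stage (suc n) ψ = stage n ψ ⊎ (ψ ≡ enumerate n × ¬ (stage n ,, enumerate n ⊢ₕ φ))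

    stage-⊬ : ∀ n → ¬ stage n ⊢ₕ φ
    stage-⊬ zero    = Γ⊬φ
    stage-⊬ (suc n) d with decide (stage n ,, enumerate n ⊢ₕ φ)
    ... | yes d′ = stage-⊬ n (⊢ₕ-mono [ (λ ψ∈ → ψ∈) , (λ (_ , ⊬) → ⊥-elim (⊬ d′)) ] d)
    ... | no ⊬   = ⊬ (⊢ₕ-mono (map₂ proj₁) d)

    D : FSet
    D = ⋃ stage

    D-⊬ : ¬ D ⊢ₕ φ
    D-⊬ d = let (n , dn) = ⋃-compact stage (λ _ → inj₁) d in stage-⊬ n dn

    ∉D⇒⊢⇒φ : ∀ {ψ} → ¬ D ψ → D ⊢ₕ ψ ⇒ φ
    ∉D⇒⊢⇒φ {ψ} ψ∉D with enumerate-surjective ψ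
    ... | n , refl =
      deduction (⊢ₕ-mono (map₁ (n ,_)) (by-contradiction λ ⊬ → ψ∉D (suc n , inj₂ (refl , ⊬))))

    D-prime : ∀ {ψ χ} → D (ψ ∨' χ) → D ψ ⊎ D χ
    D-prime {ψ} {χ} ψ∨χ with decide (D ψ) | decide (D χ)
    ... | yes ψ∈D | _       = inj₁ ψ∈D
    ... | no _    | yes χ∈D = inj₂ χ∈D
    ... | no ψ∉D  | no χ∉D  =
      ⊥-elim (D-⊬ (app (app (app (thm (ax-∨E ψ χ φ)) (∉D⇒⊢⇒φ ψ∉D)) (∉D⇒⊢⇒φ χ∉D)) (hyp ψ∨χ)))

    theory : PrimeTheory
    theory = record
      { formulas   = D
      ; closed     = λ d → by-contradiction λ ψ∉D → D-⊬ (app (∉D⇒⊢⇒φ ψ∉D) d)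
      ; prime      = D-prime
      ; consistent = λ ⊥∈D → D-⊬ (app (thm (ax-⊥E φ)) (hyp ⊥∈D))
      }

  lindenbaum : ∀ {Γ φ} → ¬ Γ ⊢ₕ φ → Σ PrimeTheory λ T → Γ ⊆ formulas T × ¬ T ∋ φ
  lindenbaum {Γ} {φ} Γ⊬φ = theory , (0 ,_) , D-⊬ ∘ hyp
    where open Lindenbaum Γ φ Γ⊬φ

  prime-valid⇒WW : ∀ {a b} → (∀ T → T ∋ a → T ∋ b) → WW (a ⇒ b)
  prime-valid⇒WW {a} {b} a⊨b = by-contradiction λ ⊬ →
    let (T , a∈T , b∉T) = lindenbaum {∅ ,, a} {b} (⊬ ∘ ∅⊢ₕ⇒WW ∘ deduction)
    in b∉T (a⊨b T (a∈T (inj₂ refl)))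

  ∋-𝖶-cong : ∀ {a b} → (∀ U → U ∋ a ⇔ U ∋ b) → ∀ T → T ∋ 𝖶 a → T ∋ 𝖶 b
  ∋-𝖶-cong a≡b T =
    ∋-mp T (∋-WW T (mp (ax-∧E₁ _ _) (re (mp (mp (ax-∧I _ _) (prime-valid⇒WW (to ∘ a≡b)))
                                              (prime-valid⇒WW (from ∘ a≡b))))))

  _⊂_ : PrimeTheory → PrimeTheory → Set
  T ⊂ U = formulas T ⊆ formulas U × ∃ λ ψ → U ∋ ψ × ¬ T ∋ ψ

  -- Distinct records may contain the same formulas, so plain inclusion would not be
  -- antisymmetric with respect to _≡_.
  _≼_ : PrimeTheory → PrimeTheory → Set₁
  T ≼ U = T ≡ U ⊎ T ⊂ U

  ≼⇒⊆ : ∀ {T U} → T ≼ U → formulas T ⊆ formulas U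
  ≼⇒⊆ (inj₁ refl)       ψ∈T = ψ∈T
  ≼⇒⊆ (inj₂ (T⊆U , _)) ψ∈T = T⊆U ψ∈T

  ≼-trans : ∀ {T U V} → T ≼ U → U ≼ V → T ≼ V
  ≼-trans (inj₁ refl)                    U≼V         = U≼V
  ≼-trans (inj₂ T⊂U)                     (inj₁ refl) = inj₂ T⊂U
  ≼-trans (inj₂ (T⊆U , ψ , ψ∈U , ψ∉T)) (inj₂ (U⊆V , _)) = inj₂ (U⊆V ∘ T⊆U , ψ , U⊆V ψ∈U , ψ∉T)

  ≼-antisym : ∀ {T U} → T ≼ U → U ≼ T → T ≡ U
  ≼-antisym (inj₁ T≡U)       _                            = T≡U
  ≼-antisym (inj₂ _)         (inj₁ U≡T)                   = sym U≡T
  ≼-antisym (inj₂ (T⊆U , _)) (inj₂ (_ , ψ , ψ∈T , ψ∉U)) = ⊥-elim (ψ∉U (T⊆U ψ∈T))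

  ≼-isPartialOrder : IsPartialOrder _≡_ _≼_
  ≼-isPartialOrder = record
    { isPreorder = record { isEquivalence = ≡-isEquivalence ; reflexive = inj₁ ; trans = ≼-trans }
    ; antisym    = ≼-antisym
    }

  ⊆⇒≼⊎⊇ : ∀ {T U} → formulas T ⊆ formulas U → T ≼ U ⊎ formulas U ⊆ formulas T
  ⊆⇒≼⊎⊇ {T} {U} T⊆U with decide (∃ λ ψ → U ∋ ψ × ¬ T ∋ ψ)
  ... | yes new = inj₁ (inj₂ (T⊆U , new))
  ... | no none = inj₂ λ ψ∈U → by-contradiction λ ψ∉T → none (_ , ψ∈U , ψ∉T)

  ⇒-counterexample : ∀ {T a b} → ¬ T ∋ a ⇒ b → Σ PrimeTheory λ U → T ≼ U × U ∋ a × ¬ U ∋ b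
  ⇒-counterexample {T} {a} {b} a⇒b∉T with lindenbaum {formulas T ,, a} {b} (a⇒b∉T ∘ closed T ∘ deduction)
  ... | V , T,a⊆V , b∉V with ⊆⇒≼⊎⊇ {T} {V} (T,a⊆V ∘ inj₁)
  ...   | inj₁ T≼V = V , T≼V , T,a⊆V (inj₂ refl) , b∉V
  ...   | inj₂ V⊆T = T , inj₁ refl , V⊆T (T,a⊆V (inj₂ refl)) , b∉V ∘ T,a⊆V ∘ inj₁

  ‖_‖ : Formula → PrimeTheory → Set₁
  ‖ ψ ‖ T = Lift (lsuc 0ℓ) (T ∋ ψ)

  ‖‖-∧ : ∀ {ψ χ} U → (‖ ψ ‖ U × ‖ χ ‖ U) ⇔ ‖ ψ ∧' χ ‖ U
  ‖‖-∧ U = mk⇔ (lift ∘ from (∋-∧⇔ U) ∘ map lower lower) (map lift lift ∘ to (∋-∧⇔ U) ∘ lower)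

  𝒩ᶜ : PrimeTheory → (PrimeTheory → Set₁) → Set₁
  𝒩ᶜ T X = ∃ λ ψ → ‖ 𝖶 ψ ‖ T × (∀ U → X U ⇔ ‖ ψ ‖ U)

  𝒩ᶜ-ext : ∀ {T} X Y → (∀ U → X U ⇔ Y U) → 𝒩ᶜ T X → 𝒩ᶜ T Y
  𝒩ᶜ-ext X Y X≐Y (ψ , 𝖶ψ , X≐ψ) = ψ , 𝖶ψ , λ U → ⇔-trans (⇔-sym (X≐Y U)) (X≐ψ U)

  𝒩ᶜ-mono : ∀ {T U} X → T ≼ U → 𝒩ᶜ T X → 𝒩ᶜ U X
  𝒩ᶜ-mono X T≼U (ψ , lift 𝖶ψ , X≐ψ) = ψ , lift (≼⇒⊆ T≼U 𝖶ψ) , X≐ψ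

  𝒩ᶜ-∩ : ∀ {T} X Y → 𝒩ᶜ T X → 𝒩ᶜ T Y → 𝒩ᶜ T (λ U → X U × Y U)
  𝒩ᶜ-∩ {T} X Y (ψ , lift 𝖶ψ , X≐ψ) (χ , lift 𝖶χ , Y≐χ) =
    ψ ∧' χ ,
    lift (∋-mp T (∋-WW T (ax-W∧ ψ χ)) (from (∋-∧⇔ T) (𝖶ψ , 𝖶χ))) ,
    λ U → ⇔-trans (X≐ψ U ×-⇔ Y≐χ U) (‖‖-∧ U)

  canonicalFrame : Frame (lsuc 0ℓ)
  canonicalFrame = record
    { W       = PrimeTheory
    ; _≤_     = _≼_
    ; isPO    = ≼-isPartialOrder
    ; 𝒩       = 𝒩ᶜ
    ; 𝒩-ext   = λ {T} → 𝒩ᶜ-ext {T}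
    ; cond-i  = λ X T≼U X∈𝒩 _ → 𝒩ᶜ-mono X T≼U X∈𝒩
    ; cond-ii = λ {T} → 𝒩ᶜ-∩ {T}
    }

  canonicalFrame-monotone : Monotone canonicalFrame
  canonicalFrame-monotone = 𝒩ᶜ-mono

  canonicalModel : Model (lsuc 0ℓ)
  canonicalModel = record
    { frame = canonicalFrame
    ; V     = ‖_‖ ∘ var
    ; V-up  = λ _ T≼U → lift ∘ ≼⇒⊆ T≼U ∘ lower
    }

  infix 3.5 _⊩ᶜ_
  _⊩ᶜ_ : PrimeTheory → Formula → Set₁
  _⊩ᶜ_ = _⊩_ canonicalModel

  truth : ∀ φ T → (T ⊩ᶜ φ) ⇔ T ∋ φ
  truth (var q)  T = mk⇔ lower lift
  truth ⊥'       T = mk⇔ (λ { (lift ()) }) (⊥-elim ∘ consistent T)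
  truth (a ∧' b) T = ⇔-trans (truth a T ×-⇔ truth b T) (⇔-sym (∋-∧⇔ T))
  truth (a ∨' b) T = ⇔-trans (truth a T ⊎-⇔ truth b T) (⇔-sym (∋-∨⇔ T))
  truth (a ⇒ b)  T = mk⇔ forced⇒∋ ∋⇒forced
    where
    forced⇒∋ : T ⊩ᶜ a ⇒ b → T ∋ a ⇒ b
    forced⇒∋ a⇒b = by-contradiction λ a⇒b∉T →
      let (U , T≼U , a∈U , b∉U) = ⇒-counterexample a⇒b∉T
      in b∉U (to (truth b U) (a⇒b U T≼U (from (truth a U) a∈U)))
    ∋⇒forced : T ∋ a ⇒ b → T ⊩ᶜ a ⇒ b
    ∋⇒forced a⇒b U T≼U ⊩a = from (truth b U) (∋-mp U (≼⇒⊆ T≼U a⇒b) (to (truth a U) ⊩a))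
  truth (𝖶 a) T = mk⇔ forced⇒∋ ∋⇒forced
    where
    forced⇒∋ : T ⊩ᶜ 𝖶 a → T ∋ 𝖶 a
    forced⇒∋ (_ , χ , lift 𝖶χ , a≐χ) =
      ∋-𝖶-cong (λ U → ⇔-trans (mk⇔ lift lower) (⇔-trans (⇔-sym (a≐χ U)) (truth a U))) T 𝖶χ
    ∋⇒forced : T ∋ 𝖶 a → T ⊩ᶜ 𝖶 a
    ∋⇒forced 𝖶a =
      (λ U T≼U ⊩a → ⊥-elim (consistent U (∋-mp U (∋-mp U (∋-WW U (ax-W¬ a)) (≼⇒⊆ T≼U 𝖶a)) (to (truth a U) ⊩a)))) ,
      a , lift 𝖶a , λ U → ⇔-trans (truth a U) (mk⇔ lift lower)

  complete : ∀ {Cls} → Cls canonicalFrame → StronglyComplete (lsuc 0ℓ) Cls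
  complete canonical∈Cls Γ φ Γ⊬φ =
    let (T , Γ⊆T , φ∉T) = lindenbaum (Γ⊬φ ∘ ⊢ₕ⇒⊢)
    in canonicalModel , canonical∈Cls , T , (λ _ γ∈Γ → from (truth _ T) (Γ⊆T γ∈Γ)) , φ∉T ∘ to (truth φ T)

mainTheorem6 : ExcludedMiddle (lsuc 0ℓ) →
    StronglyComplete (lsuc 0ℓ) AllFrames × StronglyComplete (lsuc 0ℓ) Monotone
mainTheorem6 em = complete (lift tt) , complete (λ {T} {U} → canonicalFrame-monotone {T} {U})
  where open Canonical em
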